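{- Let $G$ and $H$ be graphs without isolated vertices. Then \[ min_D(G\times H)\leq \min\{\,min_D(G)\,|V(H)|,\ min_D(H)\,|V(G)|\,\}.\]
   Context: All graphs are finite and simple. In the irreversible majority conversion process on a graph $G$, every vertex is black or white at each discrete time step $t=0,1,2,\ldots$. A black vertex stays black forever. A white vertex $v$ of degree $\deg_G(v)\geq 1$ becomes black at time $t$ if at least $\deg_G(v)/2$ of its neighbors are black at time $t-1$. An isolated vertex never changes color. A dynamo of $G$ is a set $D\subseteq V(G)$ such that, if exactly the vertices of $D$ are black at time $0$, then every vertex of $G$ is eventually black. $min_D(G)$ denotes the minimum size of a dynamo of $G$. The tensor product $G\times H$ has vertex set $V(G)\times V(H)$. In it, $(u,u')$ and $(v,v')$ are adjacent if and only if $uv\in E(G)$ and $u'v'\in E(H)$. -}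

module Defs where

open import Data.Nat using (ℕ; zero; suc; _+_; _*_; _≤_; _≤ᵇ_)
open import Data.Bool using (Bool; true; false; _∧_; _∨_; if_then_else_)
open import Data.Fin using (Fin; zero; suc; remQuot)
open import Data.Product using (Σ; _×_; _,_; proj₁; proj₂; ∃)
open import Relation.Binary.PropositionalEquality using (_≡_; refl; cong₂)
open import Function using (_∘_)

record Graph : Set where
  field
    n      : ℕ
    adj    : Fin n → Fin n → Bool
    sym    : ∀ u v → adj u v ≡ adj v u
    irrefl : ∀ v → adj v v ≡ false
open Graph public

count : ∀ {k} → (Fin k → Bool) → ℕ
count {zero}  P = 0
count {suc k} P = (if P zero then 1 else 0) + count {k} (P ∘ suc)

-- a colouring / vertex subset of G: true = black / member
Colouring : Graph → Set
Colouring G = Fin (n G) → Bool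

order : Graph → ℕ
order G = n G

size : (G : Graph) → Colouring G → ℕ
size G D = count D

deg : (G : Graph) → Fin (n G) → ℕ
deg G v = count (adj G v)

NoIsolated : Graph → Set
NoIsolated G = ∀ v → 1 ≤ deg G v

blackNbrs : (G : Graph) → Colouring G → Fin (n G) → ℕ
blackNbrs G c v = count (λ w → adj G v w ∧ c w)

-- one step of the irreversible majority process: black stays black; a white
-- vertex of degree ≥ 1 becomes black iff  deg v / 2 ≤ #black nbrs,
-- i.e. deg v ≤ 2 * #black nbrs; isolated vertices never change.
step : (G : Graph) → Colouring G → Colouring G
step G c v = c v ∨ ((1 ≤ᵇ deg G v) ∧ (deg G v ≤ᵇ 2 * blackNbrs G c v))

stateAt : (G : Graph) → Colouring G → ℕ → Colouring G
stateAt G D zero    = D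
stateAt G D (suc t) = step G (stateAt G D t)

IsDynamo : (G : Graph) → Colouring G → Set
IsDynamo G D = ∃ λ t → ∀ v → stateAt G D t v ≡ true

IsMinDynamoSize : Graph → ℕ → Set
IsMinDynamoSize G k =
  (∃ λ D → IsDynamo G D × size G D ≡ k) × (∀ D → IsDynamo G D → k ≤ size G D)

-- tensor product G × H on Fin (n G * n H); vertex x corresponds to the pair
-- remQuot (n H) x = (i , j) (inverse of Data.Fin.combine i j).
fstV : (G H : Graph) → Fin (n G * n H) → Fin (n G)
fstV G H x = proj₁ (remQuot {n G} (n H) x)

sndV : (G H : Graph) → Fin (n G * n H) → Fin (n H)
sndV G H x = proj₂ (remQuot {n G} (n H) x)

tensorAdj : (G H : Graph) → Fin (n G * n H) → Fin (n G * n H) → Bool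
tensorAdj G H x y =
  adj G (fstV G H x) (fstV G H y) ∧ adj H (sndV G H x) (sndV G H y)

tensorAdj-sym : (G H : Graph) → ∀ x y → tensorAdj G H x y ≡ tensorAdj G H y x
tensorAdj-sym G H x y = cong₂ _∧_ (Graph.sym G _ _) (Graph.sym H _ _)

tensorAdj-irrefl : (G H : Graph) → ∀ x → tensorAdj G H x x ≡ false
tensorAdj-irrefl G H x rewrite Graph.irrefl G (fstV G H x) = refl

tensor : Graph → Graph → Graph
tensor G H = record
  { n = n G * n H
  ; adj = tensorAdj G H
  ; sym = tensorAdj-sym G H
  ; irrefl = tensorAdj-irrefl G H
  }

-- Both projections of G × H scale neighbourhoods uniformly: (u , w) has
-- deg u · deg w neighbours, and deg w of them over each neighbour of u. Hence if
-- a set S of G is pulled back to S × V(H), the majority condition at u in G,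
-- multiplied by deg w ≥ 1, becomes the majority condition at (u , w). By
-- induction on time the process started from D × V(H) dominates the pullback of
-- the process started from D, so a dynamo D of G yields a dynamo of G × H of size
-- |D| · |V(H)|; symmetrically for H.
module Submission where

open import Defs hiding (sym)
open import Data.Nat using (ℕ; zero; suc; _+_; _*_; _≤_; _⊓_; z≤n; s≤s)
open import Data.Nat.Properties
  using (+-assoc; ≤-trans; ≤-reflexive; m≤n⇒m≤1+n; *-mono-≤; *-monoʳ-≤; *-comm;
         *-distribʳ-+; *-identityˡ; ⊓-glb; ≤ᵇ⇒≤; ≤⇒≤ᵇ; *-commutativeSemigroup)
open import Data.Bool using (Bool; true; false; _∧_; if_then_else_; T)
open import Data.Bool.Properties using (T-≡; T-∧; T-∨; ∧-assoc; ∧-identityʳ; ∧-commutativeMonoid)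
open import Data.Empty using (⊥-elim)
open import Data.Fin using (Fin; zero; suc; remQuot; _↑ˡ_; _↑ʳ_)
open import Data.Fin.Properties using (remQuot-combine; splitAt-↑ʳ)
open import Data.Product using (_×_; _,_; proj₁; proj₂)
import Data.Product as Product
open import Data.Sum using (_⊎_)
import Data.Sum as Sum
open import Function using (_∘_; id)
open import Function.Bundles using (Equivalence)
open import Relation.Binary.PropositionalEquality
  using (_≡_; refl; sym; trans; cong; cong₂; module ≡-Reasoning)
open import Algebra.Bundles using (CommutativeMonoid)
import Algebra.Properties.CommutativeSemigroup as CommSemigroupProperties

open Equivalence using (to; from)
open CommSemigroupProperties (CommutativeMonoid.commutativeSemigroup ∧-commutativeMonoid)
  using () renaming (xy∙z≈xz∙y to ∧-right-comm)
open CommSemigroupProperties *-commutativeSemigroup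
  using () renaming (x∙yz≈y∙xz to *-left-comm)

infix 4 _⊆_

_⊆_ : ∀ {k} → (Fin k → Bool) → (Fin k → Bool) → Set
c ⊆ c′ = ∀ x → T (c x) → T (c′ x)

indicator : Bool → ℕ
indicator b = if b then 1 else 0

count-ext : ∀ {k} {f g : Fin k → Bool} → (∀ x → f x ≡ g x) → count f ≡ count g
count-ext {zero}  f≗g = refl
count-ext {suc k} f≗g = cong₂ _+_ (cong indicator (f≗g zero)) (count-ext (f≗g ∘ suc))

count-mono : ∀ {k} {f g : Fin k → Bool} → f ⊆ g → count f ≤ count g
count-mono {zero}          f⊆g = z≤n
count-mono {suc k} {f} {g} f⊆g with f zero | g zero | f⊆g zero
... | true  | true  | _    = s≤s (count-mono (f⊆g ∘ suc))
... | true  | false | t⇒⊥ = ⊥-elim (t⇒⊥ _)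
... | false | true  | _    = m≤n⇒m≤1+n (count-mono (f⊆g ∘ suc))
... | false | false | _    = count-mono (f⊆g ∘ suc)

count-true : ∀ k → count {k} (λ _ → true) ≡ k
count-true zero    = refl
count-true (suc k) = cong suc (count-true k)

count-false : ∀ k → count {k} (λ _ → false) ≡ 0
count-false zero    = refl
count-false (suc k) = count-false k

count-∧ˡ : ∀ {k} b (Q : Fin k → Bool) → count (λ j → b ∧ Q j) ≡ indicator b * count Q
count-∧ˡ     true  Q = sym (*-identityˡ (count Q))
count-∧ˡ {k} false Q = count-false k

count-++ : ∀ m {n} (f : Fin (m + n) → Bool) →
           count f ≡ count (λ i → f (i ↑ˡ n)) + count (λ j → f (m ↑ʳ j))
count-++ zero    f = refl
count-++ (suc m) f = trans (cong (indicator (f zero) +_) (count-++ m (f ∘ suc)))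
                           (sym (+-assoc (indicator (f zero)) _ _))

remQuot-↑ʳ : ∀ {m} k (y : Fin (m * k)) →
             remQuot {suc m} k (k ↑ʳ y) ≡ Product.map₁ suc (remQuot {m} k y)
remQuot-↑ʳ {m} k y rewrite splitAt-↑ʳ k (m * k) y = refl

count-remQuot-∧ : ∀ m k (P : Fin m → Bool) (Q : Fin k → Bool) →
  count {m * k} (λ x → P (proj₁ (remQuot {m} k x)) ∧ Q (proj₂ (remQuot {m} k x)))
    ≡ count P * count Q
count-remQuot-∧ zero    k P Q = refl
count-remQuot-∧ (suc m) k P Q = begin
  count (λ x → P (proj₁ (remQuot {suc m} k x)) ∧ Q (proj₂ (remQuot {suc m} k x)))
    ≡⟨ count-++ k _ ⟩
  count (λ j → P (proj₁ (remQuot {suc m} k (j ↑ˡ m * k))) ∧ Q (proj₂ (remQuot {suc m} k (j ↑ˡ m * k))))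
    + count (λ y → P (proj₁ (remQuot {suc m} k (k ↑ʳ y))) ∧ Q (proj₂ (remQuot {suc m} k (k ↑ʳ y))))
    ≡⟨ cong₂ _+_ (count-ext (λ j → cong (λ p → P (proj₁ p) ∧ Q (proj₂ p)) (remQuot-combine zero j)))
                 (count-ext (λ y → cong (λ p → P (proj₁ p) ∧ Q (proj₂ p)) (remQuot-↑ʳ k y))) ⟩
  count (λ j → P zero ∧ Q j)
    + count (λ y → P (suc (proj₁ (remQuot {m} k y))) ∧ Q (proj₂ (remQuot {m} k y)))
    ≡⟨ cong₂ _+_ (count-∧ˡ (P zero) Q) (count-remQuot-∧ m k (P ∘ suc) Q) ⟩
  indicator (P zero) * count Q + count (P ∘ suc) * count Q
    ≡⟨ *-distribʳ-+ (count Q) (indicator (P zero)) (count (P ∘ suc)) ⟨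
  count P * count Q
    ∎
  where open ≡-Reasoning

MajorityBlack : (G : Graph) → Colouring G → Fin (n G) → Set
MajorityBlack G c v = 1 ≤ deg G v × deg G v ≤ 2 * blackNbrs G c v

module _ (G : Graph) {c : Colouring G} {v : Fin (n G)} where

  step-elim : T (step G c v) → T (c v) ⊎ MajorityBlack G c v
  step-elim = Sum.map₂ (Product.map (≤ᵇ⇒≤ 1 _) (≤ᵇ⇒≤ _ _) ∘ to T-∧) ∘ to T-∨

  step-intro : T (c v) ⊎ MajorityBlack G c v → T (step G c v)
  step-intro = from T-∨ ∘ Sum.map₂ (from T-∧ ∘ Product.map ≤⇒≤ᵇ ≤⇒≤ᵇ)

blackNbrs-mono : ∀ G {c c′ : Colouring G} → c ⊆ c′ → ∀ v → blackNbrs G c v ≤ blackNbrs G c′ v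
blackNbrs-mono G c⊆c′ v =
  count-mono (λ w → from T-∧ ∘ Product.map₂ (c⊆c′ w) ∘ to T-∧)

step-mono : ∀ G {c c′ : Colouring G} → c ⊆ c′ → step G c ⊆ step G c′
step-mono G {c} {c′} c⊆c′ v = step-intro G ∘ Sum.map (c⊆c′ v) majority-mono ∘ step-elim G
  where
  majority-mono : MajorityBlack G c v → MajorityBlack G c′ v
  majority-mono = Product.map₂ (λ d≤2b → ≤-trans d≤2b (*-monoʳ-≤ 2 (blackNbrs-mono G c⊆c′ v)))

-- Equivalently: above every neighbour of φ x lie exactly weight x neighbours of x.
record ProportionalCover (K G : Graph) (φ : Fin (n K) → Fin (n G)) : Set where
  field
    weight      : Fin (n K) → ℕ
    weight-pos  : ∀ x → 1 ≤ weight x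
    deg-≡       : ∀ x → deg K x ≡ weight x * deg G (φ x)
    blackNbrs-≡ : ∀ c x → blackNbrs K (c ∘ φ) x ≡ weight x * blackNbrs G c (φ x)

module _ {K G : Graph} {φ : Fin (n K) → Fin (n G)} (cover : ProportionalCover K G φ) where
  open ProportionalCover cover

  majorityBlack-pullback : ∀ {c} x → MajorityBlack G c (φ x) → MajorityBlack K (c ∘ φ) x
  majorityBlack-pullback {c} x (1≤d , d≤2b) rewrite deg-≡ x | blackNbrs-≡ c x =
      *-mono-≤ (weight-pos x) 1≤d
    , ≤-trans (*-monoʳ-≤ (weight x) d≤2b) (≤-reflexive (*-left-comm (weight x) 2 _))

  step-pullback : ∀ c → step G c ∘ φ ⊆ step K (c ∘ φ)
  step-pullback c x = step-intro K ∘ Sum.map₂ (majorityBlack-pullback x) ∘ step-elim G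

  stateAt-pullback : ∀ D t → stateAt G D t ∘ φ ⊆ stateAt K (D ∘ φ) t
  stateAt-pullback D zero    x = id
  stateAt-pullback D (suc t) x =
    step-mono K (stateAt-pullback D t) x ∘ step-pullback (stateAt G D t) x

  dynamo-pullback : ∀ {D} → IsDynamo G D → IsDynamo K (D ∘ φ)
  dynamo-pullback {D} (t , allBlack) =
    t , λ x → to T-≡ (stateAt-pullback D t x (from T-≡ (allBlack (φ x))))

module _ (G H : Graph) where

  deg-tensor : ∀ x → deg (tensor G H) x ≡ deg G (fstV G H x) * deg H (sndV G H x)
  deg-tensor x = count-remQuot-∧ (n G) (n H) (adj G (fstV G H x)) (adj H (sndV G H x))

  fstV-cover : NoIsolated H → ProportionalCover (tensor G H) G (fstV G H)
  fstV-cover noIsolatedH = record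
    { weight      = deg H ∘ sndV G H
    ; weight-pos  = noIsolatedH ∘ sndV G H
    ; deg-≡       = λ x → trans (deg-tensor x) (*-comm (deg G (fstV G H x)) _)
    ; blackNbrs-≡ = λ c x →
        let u = fstV G H x ; w = sndV G H x in
        trans (count-ext (λ y → ∧-right-comm (adj G u (fstV G H y)) (adj H w (sndV G H y)) _))
              (trans (count-remQuot-∧ (n G) (n H) (λ v → adj G u v ∧ c v) (adj H w))
                     (*-comm (blackNbrs G c u) _))
    }

  sndV-cover : NoIsolated G → ProportionalCover (tensor G H) H (sndV G H)
  sndV-cover noIsolatedG = record
    { weight      = deg G ∘ fstV G H
    ; weight-pos  = noIsolatedG ∘ fstV G H
    ; deg-≡       = deg-tensor
    ; blackNbrs-≡ = λ c x →
        let u = fstV G H x ; w = sndV G H x in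
        trans (count-ext (λ y → ∧-assoc (adj G u (fstV G H y)) (adj H w (sndV G H y)) _))
              (count-remQuot-∧ (n G) (n H) (adj G u) (λ v → adj H w v ∧ c v))
    }

  size-∘fstV : ∀ D → size (tensor G H) (D ∘ fstV G H) ≡ size G D * order H
  size-∘fstV D =
    trans (count-ext (λ x → sym (∧-identityʳ (D (fstV G H x)))))
          (trans (count-remQuot-∧ (n G) (n H) D (λ _ → true)) (cong (count D *_) (count-true (n H))))

  size-∘sndV : ∀ E → size (tensor G H) (E ∘ sndV G H) ≡ size H E * order G
  size-∘sndV E =
    trans (count-remQuot-∧ (n G) (n H) (λ _ → true) E)
          (trans (cong (_* count E) (count-true (n G))) (*-comm (n G) (count E)))

theorem7 : (G H : Graph) → NoIsolated G → NoIsolated H →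
    (a b c : ℕ) → IsMinDynamoSize (tensor G H) a → IsMinDynamoSize G b → IsMinDynamoSize H c →
    a ≤ (b * order H) ⊓ (c * order G)
theorem7 G H noIsolatedG noIsolatedH a _ _ (_ , a≤dynamo) ((D , D-dynamo , refl) , _) ((E , E-dynamo , refl) , _) =
  ⊓-glb
    (≤-trans (a≤dynamo _ (dynamo-pullback (fstV-cover G H noIsolatedH) D-dynamo))
             (≤-reflexive (size-∘fstV G H D)))
    (≤-trans (a≤dynamo _ (dynamo-pullback (sndV-cover G H noIsolatedG) E-dynamo))
             (≤-reflexive (size-∘sndV G H E)))
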